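{- Let $n\in\mathbb{N}$. Two points $A,B\in\mathbb{Q}\cup\{\infty\}$ are neighbours in $\Gamma_0(n)\cdot I$ if and only if they can be written in reduced form as $A=\frac{a}{nc}$ and $B=\frac{b}{d}$ (in some order) with $|ad-bnc|=1$.
   Context: Work in the upper half-plane model of the hyperbolic plane; $\infty$ is written as $\frac{1}{0}$. $PSL_2(\mathbb{R})$ acts by Möbius transformations $\begin{psmallmatrix}a&b\\c&d\end{psmallmatrix}\cdot z=\frac{az+b}{cz+d}$. $\Gamma_0(n)=\{\begin{psmallmatrix}a&b\\c&d\end{psmallmatrix}\in PSL_2(\mathbb{Z}): c\equiv0 \pmod n\}$. $I$ is the geodesic from $0$ to $\infty$, and $\Gamma_0(n)\cdot I$ is the set of geodesic edges $\phi\cdot I$, $\phi\in\Gamma_0(n)$. Two points are neighbours in $\Gamma_0(n)\cdot I$ if they are the two endpoints of some edge in $\Gamma_0(n)\cdot I$. -}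

module Defs where

open import Data.Nat using (ℕ)
open import Data.Nat.GCD using (gcd)
open import Data.Integer using (ℤ; +_; -_; _+_; _-_; _*_; ∣_∣)
open import Data.Integer.Divisibility using (_∣_)
open import Data.Product using (Σ; _×_; _,_; ∃-syntax)
open import Data.Sum using (_⊎_)
open import Relation.Binary.PropositionalEquality using (_≡_)

-- A point of ℚ ∪ {∞} = ℙ¹(ℚ), given by a reduced fraction num/den,
-- i.e. a primitive integer pair (gcd(num,den) = 1); ∞ = 1/0.
record Point : Set where
  constructor mkPoint
  field
    num : ℤ
    den : ℤ
    reduced : gcd ∣ num ∣ ∣ den ∣ ≡ 1
open Point public

_≈P_ : Point → Point → Set
P ≈P Q = (num P ≡ num Q × den P ≡ den Q) ⊎ (num P ≡ - num Q × den P ≡ - den Q)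

frac : (x y : ℤ) → gcd ∣ x ∣ ∣ y ∣ ≡ 1 → Point
frac x y r = mkPoint x y r

-- Elements of SL₂(ℤ) (PSL₂(ℤ) acts through them; ±φ give the same Möbius map).
record SL2Z : Set where
  constructor mkSL2
  field
    a b c d : ℤ
    det : a * d - b * c ≡ + 1
open SL2Z public

InΓ₀ : ℕ → SL2Z → Set
InΓ₀ n φ = (+ n) ∣ c φ

-- SL₂(ℤ) preserves primitivity,
-- but to avoid building that proof here we express "φ·P ≈ Q" directly on
-- the homogeneous coordinates, up to sign.
MapsTo : SL2Z → Point → Point → Set
MapsTo φ P Q =
  let x = a φ * num P + b φ * den P
      y = c φ * num P + d φ * den P
  in (x ≡ num Q × y ≡ den Q) ⊎ (x ≡ - num Q × y ≡ - den Q)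

zeroP : Point
zeroP = mkPoint (+ 0) (+ 1) Relation.Binary.PropositionalEquality.refl

infP : Point
infP = mkPoint (+ 1) (+ 0) Relation.Binary.PropositionalEquality.refl

-- A and B are neighbours in Γ₀(n)·I: they are the two endpoints of the
-- geodesic φ·I (from φ·0 to φ·∞) for some φ ∈ Γ₀(n), in either order.
Neighbours : ℕ → Point → Point → Set
Neighbours n A B = Σ SL2Z λ φ → InΓ₀ n φ ×
  ((MapsTo φ zeroP A × MapsTo φ infP B) ⊎ (MapsTo φ zeroP B × MapsTo φ infP A))

WrittenAs : ℕ → Point → Point → Set
WrittenAs n A B = Σ ℤ λ a → Σ ℤ λ c → Σ ℤ λ b → Σ ℤ λ d →
  Σ (gcd ∣ a ∣ ∣ (+ n) * c ∣ ≡ 1) λ r₁ → Σ (gcd ∣ b ∣ ∣ d ∣ ≡ 1) λ r₂ →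
    ((A ≈P frac a ((+ n) * c) r₁ × B ≈P frac b d r₂)
      ⊎ (B ≈P frac a ((+ n) * c) r₁ × A ≈P frac b d r₂))
    × ∣ a * d - b * ((+ n) * c) ∣ ≡ 1

{-# OPTIONS --safe #-}
-- The edge φ·I runs from φ·0 = b/d to φ·∞ = a/c, read off the columns of
-- φ = (a b; c d).  Up to the common sign of a reduced fraction, the cross
-- determinant of the two endpoints is ±(ad − bc) = ±1, and n ∣ c makes the
-- denominator of φ·∞ a multiple of n.  Conversely a pair a/(nc), b/d with
-- ad − bnc = ±1 are the columns of (a b; nc d) or (a −b; nc −d) ∈ Γ₀(n).
module Submission where

open import Defs
open import Data.Nat using (ℕ)
open import Data.Nat.GCD using (gcd)
import Data.Nat.Divisibility as ℕ
open import Data.Integer using (ℤ; +_; -[1+_]; -_; _+_; _*_; _-_; ∣_∣)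
open import Data.Integer.Properties using (neg-involutive; ∣-i∣≡∣i∣; *-comm)
open import Data.Integer.Divisibility using (_∣_)
open import Data.Integer.Divisibility.Signed using (divides; ∣ᵤ⇒∣; ∣⇒∣ᵤ; ∣-refl; ∣m⇒∣m*n)
open import Data.Integer.Tactic.RingSolver using (solve-∀)
open import Data.Product using (Σ; _×_; _,_)
open import Data.Sum using (_⊎_; inj₁; inj₂)
open import Data.Sum.Function.Propositional using (_⊎-⇔_)
open import Function.Bundles using (_⇔_; mk⇔; Equivalence)
open import Function.Properties.Equivalence using () renaming (sym to ⇔-sym; trans to ⇔-trans)
open import Relation.Binary.PropositionalEquality
  using (_≡_; refl; sym; trans; cong; subst; subst₂)

open Equivalence using (to; from)

-- Equality of homogeneous coordinates up to a common sign: both _≈P_ and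
-- MapsTo unfold to instances of it.
infix 4 _≃±_

_≃±_ : ℤ × ℤ → ℤ × ℤ → Set
(x , y) ≃± (u , v) = (x ≡ u × y ≡ v) ⊎ (x ≡ - u × y ≡ - v)

≃±-sym : ∀ {x y u v} → (x , y) ≃± (u , v) → (u , v) ≃± (x , y)
≃±-sym (inj₁ (refl , refl)) = inj₁ (refl , refl)
≃±-sym {u = u} {v} (inj₂ (refl , refl)) =
  inj₂ (sym (neg-involutive u) , sym (neg-involutive v))

≃±-trans : ∀ {x y u v s t} →
  (x , y) ≃± (u , v) → (u , v) ≃± (s , t) → (x , y) ≃± (s , t)
≃±-trans (inj₁ (refl , refl)) q = q
≃±-trans (inj₂ (refl , refl)) (inj₁ (refl , refl)) = inj₂ (refl , refl)
≃±-trans {s = s} {t} (inj₂ (refl , refl)) (inj₂ (refl , refl)) =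
  inj₁ (neg-involutive s , neg-involutive t)

≃±-∣ : ∀ {k x y u v} → (x , y) ≃± (u , v) → k ∣ v → k ∣ y
≃±-∣ (inj₁ (refl , refl)) k∣v = k∣v
≃±-∣ {k} {v = v} (inj₂ (refl , refl)) k∣v = subst (∣ k ∣ ℕ.∣_) (sym (∣-i∣≡∣i∣ v)) k∣v

det-negʳ : ∀ a b c d → a * - d - - b * c ≡ - (a * d - b * c)
det-negʳ = solve-∀

≃±-∣det∣ : ∀ {x y u v a c b d} →
  (x , y) ≃± (a , c) → (u , v) ≃± (b , d) →
  ∣ x * v - u * y ∣ ≡ ∣ a * d - b * c ∣
≃±-∣det∣ (inj₁ (refl , refl)) (inj₁ (refl , refl)) = refl
≃±-∣det∣ {a = a} {c} {b} {d} (inj₁ (refl , refl)) (inj₂ (refl , refl)) =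
  trans (cong ∣_∣ (det-negʳ a b c d)) (∣-i∣≡∣i∣ (a * d - b * c))
≃±-∣det∣ {a = a} {c} {b} {d} (inj₂ (refl , refl)) (inj₁ (refl , refl)) =
  trans (cong ∣_∣ (det-negˡ a b c d)) (∣-i∣≡∣i∣ (a * d - b * c))
  where
  det-negˡ : ∀ a b c d → - a * d - b * - c ≡ - (a * d - b * c)
  det-negˡ = solve-∀
≃±-∣det∣ {a = a} {c} {b} {d} (inj₂ (refl , refl)) (inj₂ (refl , refl)) =
  cong ∣_∣ (det-negˡʳ a b c d)
  where
  det-negˡʳ : ∀ a b c d → - a * - d - - b * - c ≡ a * d - b * c
  det-negˡʳ = solve-∀

∣i∣≡1⇒i≡±1 : ∀ {i} → ∣ i ∣ ≡ 1 → i ≡ + 1 ⊎ i ≡ - + 1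
∣i∣≡1⇒i≡±1 {+ .1}      refl = inj₁ refl
∣i∣≡1⇒i≡±1 { -[1+ 0 ]} refl = inj₂ refl

completeToSL2Z : ∀ a b c d → ∣ a * d - b * c ∣ ≡ 1 →
  Σ SL2Z λ φ → (SL2Z.a φ , SL2Z.c φ) ≃± (a , c) × (SL2Z.b φ , SL2Z.d φ) ≃± (b , d)
completeToSL2Z a b c d unimodular with ∣i∣≡1⇒i≡±1 unimodular
... | inj₁ det≡1  = mkSL2 a b c d det≡1 , inj₁ (refl , refl) , inj₁ (refl , refl)
... | inj₂ det≡-1 =
  mkSL2 a (- b) c (- d) (trans (det-negʳ a b c d) (cong -_ det≡-1)) ,
  inj₁ (refl , refl) , inj₂ (refl , refl)

mapsTo-zero : ∀ φ Q → MapsTo φ zeroP Q ⇔ (SL2Z.b φ , SL2Z.d φ) ≃± (num Q , den Q)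
mapsTo-zero (mkSL2 a b c d _) Q = mk⇔
  (subst₂ (λ x y → (x , y) ≃± (num Q , den Q)) (column a b) (column c d))
  (subst₂ (λ x y → (x , y) ≃± (num Q , den Q)) (sym (column a b)) (sym (column c d)))
  where
  column : ∀ x y → x * + 0 + y * + 1 ≡ y
  column = solve-∀

mapsTo-infinity : ∀ φ Q → MapsTo φ infP Q ⇔ (SL2Z.a φ , SL2Z.c φ) ≃± (num Q , den Q)
mapsTo-infinity (mkSL2 a b c d _) Q = mk⇔
  (subst₂ (λ x y → (x , y) ≃± (num Q , den Q)) (column a b) (column c d))
  (subst₂ (λ x y → (x , y) ≃± (num Q , den Q)) (sym (column a b)) (sym (column c d)))
  where
  column : ∀ x y → x * + 1 + y * + 0 ≡ x
  column = solve-∀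

OrientedNeighbours : ℕ → Point → Point → Set
OrientedNeighbours n P Q =
  Σ SL2Z λ φ → InΓ₀ n φ × MapsTo φ infP P × MapsTo φ zeroP Q

OrientedWrittenAs : ℕ → Point → Point → Set
OrientedWrittenAs n P Q = Σ ℤ λ a → Σ ℤ λ c → Σ ℤ λ b → Σ ℤ λ d →
  Σ (gcd ∣ a ∣ ∣ (+ n) * c ∣ ≡ 1) λ r₁ → Σ (gcd ∣ b ∣ ∣ d ∣ ≡ 1) λ r₂ →
    (P ≈P frac a ((+ n) * c) r₁ × Q ≈P frac b d r₂)
    × ∣ a * d - b * ((+ n) * c) ∣ ≡ 1

neighbours⇔oriented : ∀ n A B →
  Neighbours n A B ⇔ (OrientedNeighbours n B A ⊎ OrientedNeighbours n A B)
neighbours⇔oriented _ _ _ = mk⇔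
  (λ { (φ , n∣c , inj₁ (φ0≃A , φ∞≃B)) → inj₁ (φ , n∣c , φ∞≃B , φ0≃A)
     ; (φ , n∣c , inj₂ (φ0≃B , φ∞≃A)) → inj₂ (φ , n∣c , φ∞≃A , φ0≃B) })
  (λ { (inj₁ (φ , n∣c , φ∞≃B , φ0≃A)) → φ , n∣c , inj₁ (φ0≃A , φ∞≃B)
     ; (inj₂ (φ , n∣c , φ∞≃A , φ0≃B)) → φ , n∣c , inj₂ (φ0≃B , φ∞≃A) })

writtenAs⇔oriented : ∀ n A B →
  WrittenAs n A B ⇔ (OrientedWrittenAs n B A ⊎ OrientedWrittenAs n A B)
writtenAs⇔oriented _ _ _ = mk⇔
  (λ { (a , c , b , d , r₁ , r₂ , inj₁ A,B , unimodular) →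
         inj₂ (a , c , b , d , r₁ , r₂ , A,B , unimodular)
     ; (a , c , b , d , r₁ , r₂ , inj₂ B,A , unimodular) →
         inj₁ (a , c , b , d , r₁ , r₂ , B,A , unimodular) })
  (λ { (inj₁ (a , c , b , d , r₁ , r₂ , B,A , unimodular)) →
         a , c , b , d , r₁ , r₂ , inj₂ B,A , unimodular
     ; (inj₂ (a , c , b , d , r₁ , r₂ , A,B , unimodular)) →
         a , c , b , d , r₁ , r₂ , inj₁ A,B , unimodular })

unimodular⇒writtenAs : ∀ {n} P Q → (+ n) ∣ den P →
  ∣ num P * den Q - num Q * den P ∣ ≡ 1 → OrientedWrittenAs n P Q
unimodular⇒writtenAs {n} (mkPoint p q r) Q n∣q unimodular with ∣ᵤ⇒∣ {+ n} {q} n∣q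
... | divides c refl =
  p , c , num Q , den Q ,
  subst (λ z → gcd ∣ p ∣ ∣ z ∣ ≡ 1) c*n≡n*c r , reduced Q ,
  (inj₁ (refl , c*n≡n*c) , inj₁ (refl , refl)) ,
  subst (λ z → ∣ p * den Q - num Q * z ∣ ≡ 1) c*n≡n*c unimodular
  where
  c*n≡n*c : c * + n ≡ + n * c
  c*n≡n*c = *-comm c (+ n)

orientedNeighbours⇒writtenAs : ∀ n P Q →
  OrientedNeighbours n P Q → OrientedWrittenAs n P Q
orientedNeighbours⇒writtenAs n P Q (φ , n∣c , φ∞≃P , φ0≃Q) =
  unimodular⇒writtenAs P Q (≃±-∣ {+ n} P≃φ∞ n∣c)
    (trans (≃±-∣det∣ P≃φ∞ Q≃φ0) (cong ∣_∣ (det φ)))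
  where
  P≃φ∞ : (num P , den P) ≃± (SL2Z.a φ , SL2Z.c φ)
  P≃φ∞ = ≃±-sym (to (mapsTo-infinity φ P) φ∞≃P)
  Q≃φ0 : (num Q , den Q) ≃± (SL2Z.b φ , SL2Z.d φ)
  Q≃φ0 = ≃±-sym (to (mapsTo-zero φ Q) φ0≃Q)

writtenAs⇒orientedNeighbours : ∀ n P Q →
  OrientedWrittenAs n P Q → OrientedNeighbours n P Q
writtenAs⇒orientedNeighbours n P Q (a , c , b , d , _ , _ , (P≃ , Q≃) , unimodular)
  with completeToSL2Z a b (+ n * c) d unimodular
... | φ , φ∞≃ , φ0≃ =
  φ , ≃±-∣ {+ n} φ∞≃ (∣⇒∣ᵤ (∣m⇒∣m*n {+ n} c ∣-refl)) ,
  from (mapsTo-infinity φ P) (≃±-trans φ∞≃ (≃±-sym P≃)) ,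
  from (mapsTo-zero φ Q) (≃±-trans φ0≃ (≃±-sym Q≃))

orientedNeighbours⇔writtenAs : ∀ n P Q → OrientedNeighbours n P Q ⇔ OrientedWrittenAs n P Q
orientedNeighbours⇔writtenAs n P Q =
  mk⇔ (orientedNeighbours⇒writtenAs n P Q) (writtenAs⇒orientedNeighbours n P Q)

mainTheorem9 : (n : ℕ) (A B : Point) → Neighbours n A B ⇔ WrittenAs n A B
mainTheorem9 n A B =
  ⇔-trans (neighbours⇔oriented n A B)
    (⇔-trans (orientedNeighbours⇔writtenAs n B A ⊎-⇔ orientedNeighbours⇔writtenAs n A B)
             (⇔-sym (writtenAs⇔oriented n A B)))
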